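{- Let $\vec S$ be a universe of set separations, let $(T,\alpha)$ be a tame $S$-tree, let $\vec e\in\vec E(T)$ with $\alpha(\vec e)=(A,B)$, and let $(X,Y)\in\vec S$ with $(A,B)\le(X,Y)$. Then the shift of $(T,\alpha)$ onto $(X,Y)$ with respect to $\vec e$ is a tame $S$-tree.
   Context: $\mathrm{sep}(V)=\{(A,B):A\cup B=V\}$ is ordered by $(A,B)\le(C,D)$ iff $A\subseteq C$ and $B\supseteq D$, with involution $(A,B)^*=(B,A)$. A universe of set separations is a subset $\vec S\subseteq\mathrm{sep}(V)$ closed under $*$ and under $(A,B)\wedge(C,D)=(A\cap C,B\cup D)$ and $(A,B)\vee(C,D)=(A\cup C,B\cap D)$. A star is a finite multiset $\sigma$ of separations such that any two of its members (distinct as members of the multiset) $(A,B),(C,D)$ satisfy $(A,B)\le(D,C)$. An $S$-tree is a pair $(T,\alpha)$ with $T$ a finite tree and $\alpha$ a map from the set $\vec E(T)$ of oriented edges $(x,y)$ of $T$ to $\vec S$ with $\alpha(y,x)=\alpha(x,y)^*$. For $t\in V(T)$ let $\vec F_t=\{(x,t)\in\vec E(T)\}$ and $\sigma_t=\alpha(\vec F_t)$ as a multiset; $(T,\alpha)$ is tame if every $\sigma_t$ is a star. Oriented edges are ordered by $(x,y)\le(u,v)$ iff they are equal or $T$ contains a path whose vertex sequence begins $x,y$ and ends $u,v$ (with $y=u$ allowed). For $\vec e=(x,y)$, $T(\vec e)$ is the subtree consisting of the component of $T-x$ containing $y$ together with $x$ and the edge $xy$. The shift of $(T,\alpha)$ onto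 $(X,Y)$ with respect to $\vec e$ is the pair $(T(\vec e),\alpha')$ where for each edge $f$ of $T(\vec e)$, with $\vec f$ its orientation satisfying $\vec e\le\vec f$ and $\overleftarrow f$ its reverse, $\alpha'(\vec f)=\alpha(\vec f)\vee(X,Y)$ and $\alpha'(\overleftarrow f)=\alpha(\overleftarrow f)\wedge(Y,X)$. -}

module Defs where

open import Data.Nat using (ℕ; _≤_)
open import Data.Fin using (Fin)
open import Data.List using (List; []; _∷_; head; reverse; length)
open import Data.List.Relation.Unary.All using (All)
open import Data.List.Relation.Unary.Unique.Propositional using (Unique)
open import Data.Maybe using (just)
open import Data.Product using (Σ; _×_; _,_; ∃)
open import Data.Sum using (_⊎_; inj₁; inj₂)
open import Data.Unit using (⊤)
open import Relation.Binary.PropositionalEquality using (_≡_; _≢_)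
open import Relation.Nullary using (¬_)

record Sep (V : Set) : Set₁ where
  constructor sep
  field
    L : V → Set
    R : V → Set
    .cover : ∀ v → L v ⊎ R v
open Sep public

module _ {V : Set} where

  infix 4 _≤ₛ_
  infixl 6 _∧ₛ_ _∨ₛ_
  infix 8 _*

  _≤ₛ_ : Sep V → Sep V → Set
  s ≤ₛ t = (∀ v → L s v → L t v) × (∀ v → R t v → R s v)

  _* : Sep V → Sep V
  (sep A B c) * = sep B A (λ v → swap (c v))
    where
      swap : ∀ {P Q : Set} → P ⊎ Q → Q ⊎ P
      swap (inj₁ p) = inj₂ p
      swap (inj₂ q) = inj₁ q

  _∧ₛ_ : Sep V → Sep V → Sep V
  sep A B c ∧ₛ sep C D d = sep (λ v → A v × C v) (λ v → B v ⊎ D v) (λ v → f (c v) (d v))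
    where
      f : ∀ {v} → A v ⊎ B v → C v ⊎ D v → (A v × C v) ⊎ (B v ⊎ D v)
      f (inj₁ a) (inj₁ x) = inj₁ (a , x)
      f (inj₂ b) _        = inj₂ (inj₁ b)
      f (inj₁ _) (inj₂ x) = inj₂ (inj₂ x)

  _∨ₛ_ : Sep V → Sep V → Sep V
  sep A B c ∨ₛ sep C D d = sep (λ v → A v ⊎ C v) (λ v → B v × D v) (λ v → f (c v) (d v))
    where
      f : ∀ {v} → A v ⊎ B v → C v ⊎ D v → (A v ⊎ C v) ⊎ (B v × D v)
      f (inj₂ b) (inj₂ x) = inj₂ (b , x)
      f (inj₁ a) _        = inj₁ (inj₁ a)
      f (inj₂ _) (inj₁ x) = inj₁ (inj₂ x)

record Universe (V : Set) : Set₁ where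
  field
    _∈S : Sep V → Set
    *-closed : ∀ s → s ∈S → (s *) ∈S
    ∧-closed : ∀ s t → s ∈S → t ∈S → (s ∧ₛ t) ∈S
    ∨-closed : ∀ s t → s ∈S → t ∈S → (s ∨ₛ t) ∈S
open Universe public

record Graph (n : ℕ) : Set₁ where
  field
    Vx  : Fin n → Set
    Adj : Fin n → Fin n → Set
open Graph public

module _ {n : ℕ} (G : Graph n) where

  Consec : List (Fin n) → Set
  Consec []           = ⊤
  Consec (_ ∷ [])     = ⊤
  Consec (a ∷ b ∷ ps) = Adj G a b × Consec (b ∷ ps)

  IsPath : List (Fin n) → Set
  IsPath ps = All (Vx G) ps × Consec ps × Unique ps

  PathBetween : Fin n → Fin n → List (Fin n) → Set
  PathBetween a b ps = IsPath ps × head ps ≡ just a × head (reverse ps) ≡ just b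

  IsSimpleGraph : Set
  IsSimpleGraph =
    (∀ a b → Adj G a b → Vx G a × Vx G b) ×
    (∀ a b → Adj G a b → Adj G b a) ×
    (∀ a → ¬ Adj G a a)

  Connected : Set
  Connected = ∀ a b → Vx G a → Vx G b → ∃ λ ps → PathBetween a b ps

  Acyclic : Set
  Acyclic = ∀ a b ps → PathBetween a b ps → 3 ≤ length ps → ¬ Adj G b a

  IsTree : Set
  IsTree = IsSimpleGraph × Connected × Acyclic

  -- order on oriented edges: (a,b) ≤ (c,d) iff equal or some path
  -- has vertex sequence beginning a,b and ending c,d
  _≤ₑ_ : Fin n × Fin n → Fin n × Fin n → Set
  (a , b) ≤ₑ (c , d) =
    ((a ≡ c) × (b ≡ d)) ⊎
    (∃ λ ps → ∃ λ qs → IsPath (a ∷ b ∷ ps) × reverse (a ∷ b ∷ ps) ≡ d ∷ c ∷ qs)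

module _ {V : Set} (𝕊 : Universe V) {n : ℕ} (T : Graph n) where

  AlphaMap : Set₁
  AlphaMap = (a b : Fin n) → Adj T a b → Sep V

  IsSTree : AlphaMap → Set₁
  IsSTree α =
    IsTree T ×
    (∀ a b (p : Adj T a b) → _∈S 𝕊 (α a b p)) ×
    (∀ a b (p : Adj T a b) (q : Adj T b a) → α b a q ≡ (α a b p) *)

  -- σ_t = α(F_t) is a star: distinct members (a,t),(a',t) satisfy
  -- α(a,t) ≤ α(a',t)*
  IsTame : AlphaMap → Set
  IsTame α = ∀ t a a' (p : Adj T a t) (p' : Adj T a' t) → a ≢ a' →
             α a t p ≤ₛ (α a' t p') *

  IsTameSTree : AlphaMap → Set₁
  IsTameSTree α = IsSTree α × IsTame α

-- The subtree T(e) for e = (x,y): the component of T - x containing y,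
-- together with x and the edge xy.

module _ {n : ℕ} (T : Graph n) (x y : Fin n) where

  Minus : Graph n
  Minus = record { Vx = λ z → Vx T z × z ≢ x ; Adj = λ a b → Adj T a b × a ≢ x × b ≢ x }

  InComp : Fin n → Set
  InComp z = ∃ λ ps → PathBetween Minus y z ps

  SubT : Graph n
  SubT = record
    { Vx  = λ z → InComp z ⊎ z ≡ x
    ; Adj = λ a b → (Adj (Minus) a b × InComp a × InComp b)
                    ⊎ ((a ≡ x × b ≡ y) ⊎ (a ≡ y × b ≡ x))
    }

  IsShift : {V : Set} → ((a b : Fin n) → Adj T a b → Sep V) → Sep V →
            ((a b : Fin n) → Adj SubT a b → Sep V) → Set₁
  IsShift α s α' = ∀ a b (p' : Adj SubT a b) (p : Adj T a b) →
    (_≤ₑ_ T (x , y) (a , b) → α' a b p' ≡ (α a b p ∨ₛ s)) ×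
    (_≤ₑ_ T (x , y) (b , a) → α' a b p' ≡ (α a b p ∧ₛ (s *)))

module Submission where

-- Every edge of T(e) points either away from e or towards e in T, so the shift enlarges the
-- separations on edges pointing away by joining with (X,Y) and shrinks the others by meeting
-- with (Y,X); since (r ∨ s)* = r* ∧ s*, this respects the involution. At a node t, two distinct
-- incoming edges both pointing away from e would give two paths from t to e with different first
-- steps, impossible in a tree. So in each star at most one member is enlarged and the rest shrink,
-- and joining one member and meeting the others with complementary separations keeps a star a star.

open import Defs
open import Data.Nat using (ℕ; _≤_; z≤n; s≤s)
open import Data.Fin using (Fin; _≟_)
open import Data.List using (List; []; _∷_; _++_; _∷ʳ_; [_]; head; reverse; length)
open import Data.List.Properties using (unfold-reverse; reverse-++; reverse-involutive; ++-assoc)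
open import Data.List.Relation.Unary.All as All using (All; []; _∷_)
import Data.List.Relation.Unary.All.Properties as All
open import Data.List.Relation.Unary.Any using (here; there)
import Data.List.Relation.Unary.Any.Properties as Any
open import Data.List.Relation.Unary.AllPairs using ([]; _∷_)
open import Data.List.Relation.Unary.Unique.Propositional using (Unique)
open import Data.List.Membership.Propositional using (_∈_; _∉_)
open import Data.List.Membership.Propositional.Properties using (∈-∃++)
open import Data.Maybe using (just)
open import Data.Product using (_×_; _,_; ∃; proj₁; proj₂)
open import Data.Sum using (_⊎_; inj₁; inj₂)
open import Data.Unit using (tt)
open import Data.Empty using (⊥-elim)
open import Function using (_∘_)
open import Relation.Binary.PropositionalEquality
  using (_≡_; _≢_; refl; sym; trans; cong; subst; subst₂; module ≡-Reasoning)
open import Relation.Nullary using (¬_; yes; no)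

module _ {A : Set} where

  data Last (b : A) : List A → Set where
    end  : Last b [ b ]
    skip : ∀ {a xs} → Last b xs → Last b (a ∷ xs)

  Last⇒∈ : ∀ {b xs} → Last b xs → b ∈ xs
  Last⇒∈ end      = here refl
  Last⇒∈ (skip l) = there (Last⇒∈ l)

  Last-∷ʳ : ∀ {b} xs → Last b (xs ∷ʳ b)
  Last-∷ʳ []       = end
  Last-∷ʳ (x ∷ xs) = skip (Last-∷ʳ xs)

  Last-join : ∀ {w b xs ys} → Last w xs → Last b (w ∷ ys) → Last b (xs ++ ys)
  Last-join end      l′ = l′
  Last-join (skip l) l′ = skip (Last-join l l′)

  Last-++⁻ʳ : ∀ {b w ys} xs → Last b (xs ++ w ∷ ys) → Last b (w ∷ ys)
  Last-++⁻ʳ []            l        = l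
  Last-++⁻ʳ (_ ∷ [])      (skip l) = l
  Last-++⁻ʳ (_ ∷ x ∷ xs)  (skip l) = Last-++⁻ʳ (x ∷ xs) l

  Last⇒∷ʳ : ∀ {b xs} → Last b xs → ∃ λ ws → xs ≡ ws ∷ʳ b
  Last⇒∷ʳ end = [] , refl
  Last⇒∷ʳ {xs = a ∷ _} (skip l) with Last⇒∷ʳ l
  ... | ws , refl = a ∷ ws , refl

  Last⇒reverse : ∀ {b xs} → Last b xs → ∃ λ qs → reverse xs ≡ b ∷ qs
  Last⇒reverse {b} l with Last⇒∷ʳ l
  ... | ws , refl = reverse ws , reverse-++ ws [ b ]

  Last-reverse : ∀ {b} xs → Last b (reverse (b ∷ xs))
  Last-reverse {b} xs = subst (Last b) (sym (unfold-reverse b xs)) (Last-∷ʳ (reverse xs))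

  Last⇒head-reverse : ∀ {b xs} → Last b xs → head (reverse xs) ≡ just b
  Last⇒head-reverse l = cong head (proj₂ (Last⇒reverse l))

  head-reverse⇒Last : ∀ {b} xs → head (reverse xs) ≡ just b → Last b xs
  head-reverse⇒Last {b} xs h with reverse xs in eq
  head-reverse⇒Last {b} xs refl | _ ∷ qs =
    subst (Last b) (trans (sym (cong reverse eq)) (reverse-involutive xs)) (Last-reverse qs)

  All-reverse : ∀ {Q : A → Set} {xs} → All Q xs → All Q (reverse xs)
  All-reverse qs = All.tabulate (λ m → All.lookup qs (Any.reverse⁻ m))

  Unique-++⁻ʳ : ∀ {ys : List A} xs → Unique (xs ++ ys) → Unique ys
  Unique-++⁻ʳ []       u       = u
  Unique-++⁻ʳ (_ ∷ xs) (_ ∷ u) = Unique-++⁻ʳ xs u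

  Unique-∷ʳ : ∀ {b : A} xs → Unique xs → b ∉ xs → Unique (xs ∷ʳ b)
  Unique-∷ʳ []       []      _   = [] ∷ []
  Unique-∷ʳ (x ∷ xs) (d ∷ u) b∉ =
    All.++⁺ d ((λ { refl → b∉ (here refl) }) ∷ []) ∷ Unique-∷ʳ xs u (λ m → b∉ (there m))

  Unique-reverse : ∀ (xs : List A) → Unique xs → Unique (reverse xs)
  Unique-reverse []       _       = []
  Unique-reverse (x ∷ xs) (d ∷ u) = subst Unique (sym (unfold-reverse x xs))
    (Unique-∷ʳ (reverse xs) (Unique-reverse xs u)
      (λ m → All.All¬⇒¬Any d (Any.reverse⁻ m)))

module _ {n : ℕ} where

  IsWalk : Graph n → List (Fin n) → Set
  IsWalk G ps = All (Vx G) ps × Consec G ps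

  Walk : Graph n → Fin n → Fin n → List (Fin n) → Set
  Walk G a b ws = IsWalk G (a ∷ ws) × Last b (a ∷ ws)

  _↾_ : Graph n → (Fin n → Set) → Graph n
  G ↾ Q = record { Vx = λ v → Vx G v × Q v ; Adj = Adj G }

  Subgraph : Graph n → Graph n → Set
  Subgraph G H = (∀ v → Vx G v → Vx H v) × (∀ a b → Adj G a b → Adj H a b)

  Consec-mono : ∀ {G H : Graph n} → (∀ a b → Adj G a b → Adj H a b) → ∀ xs → Consec G xs → Consec H xs
  Consec-mono f []           _       = tt
  Consec-mono f (_ ∷ [])     _       = tt
  Consec-mono f (a ∷ b ∷ xs) (e , c) = f a b e , Consec-mono f (b ∷ xs) c

  IsPath-mono : ∀ {G H : Graph n} → Subgraph G H → ∀ xs → IsPath G xs → IsPath H xs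
  IsPath-mono (fv , fa) xs (vs , c , u) = All.map (fv _) vs , Consec-mono fa xs c , u

module _ {n : ℕ} (G : Graph n) where

  open import Data.List.Membership.DecPropositional (_≟_ {n}) using (_∈?_)

  Consec-++⁻ʳ : ∀ {ys} xs → Consec G (xs ++ ys) → Consec G ys
  Consec-++⁻ʳ               []           c       = c
  Consec-++⁻ʳ {[]}          (_ ∷ xs)     _       = tt
  Consec-++⁻ʳ {_ ∷ _}       (_ ∷ [])     (_ , c) = c
  Consec-++⁻ʳ {ys@(_ ∷ _)}  (_ ∷ x ∷ xs) (_ , c) = Consec-++⁻ʳ (x ∷ xs) c

  Consec-join : ∀ {w xs ys} → Consec G xs → Last w xs → Consec G (w ∷ ys) → Consec G (xs ++ ys)
  Consec-join                     _       end      c′ = c′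
  Consec-join {xs = _ ∷ _ ∷ _} (e , c) (skip l) c′ = e , Consec-join c l c′

  Consec-reverse : (∀ a b → Adj G a b → Adj G b a) → ∀ xs → Consec G xs → Consec G (reverse xs)
  Consec-reverse adj-sym []           _       = tt
  Consec-reverse adj-sym (_ ∷ [])     _       = tt
  Consec-reverse adj-sym (a ∷ b ∷ xs) (e , c) = subst (Consec G) (sym (unfold-reverse a (b ∷ xs)))
    (Consec-join (Consec-reverse adj-sym (b ∷ xs) c) (Last-reverse xs) (adj-sym a b e , tt))

  IsPath-++⁻ʳ : ∀ {ys} xs → IsPath G (xs ++ ys) → IsPath G ys
  IsPath-++⁻ʳ xs (vs , c , u) = All.++⁻ʳ xs vs , Consec-++⁻ʳ xs c , Unique-++⁻ʳ xs u

  PathBetween⇒Last : ∀ {a b ps} → PathBetween G a b ps → ∃ λ qs → IsPath G (a ∷ qs) × Last b (a ∷ qs)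
  PathBetween⇒Last {ps = _ ∷ qs} (p , refl , hr) = qs , p , head-reverse⇒Last _ hr

  Last⇒PathBetween : ∀ {a b qs} → IsPath G (a ∷ qs) → Last b (a ∷ qs) → PathBetween G a b (a ∷ qs)
  Last⇒PathBetween p l = p , refl , Last⇒head-reverse l

  walk⇒path : ∀ {a b} ps → Walk G a b ps → ∃ λ qs → IsPath G (a ∷ qs) × Last b (a ∷ qs)
  walk⇒path [] ((va ∷ [] , _) , end) = [] , (va ∷ [] , tt , [] ∷ []) , end
  walk⇒path {a} {b} (c ∷ ps) ((va ∷ vs , e , cs) , skip l) with walk⇒path ps ((vs , cs) , l)
  ... | qs , p@(vqs , cqs , uqs) , lq with a ∈? c ∷ qs
  ... | no a∉  = c ∷ qs , (va ∷ vqs , (e , cqs) , All.¬Any⇒All¬ _ a∉ ∷ uqs) , skip lq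
  ... | yes a∈ = suffix (∈-∃++ a∈) p lq
    where
      suffix : ∀ {xs} → (∃ λ X → ∃ λ D → xs ≡ X ++ [ a ] ++ D) → IsPath G xs → Last b xs →
               ∃ λ qs → IsPath G (a ∷ qs) × Last b (a ∷ qs)
      suffix (X , D , refl) pX lX = D , IsPath-++⁻ʳ X pX , Last-++⁻ʳ X lX

  IsPath-reverse : (∀ a b → Adj G a b → Adj G b a) → ∀ xs → IsPath G xs → IsPath G (reverse xs)
  IsPath-reverse adj-sym xs (vs , c , u) = All-reverse vs , Consec-reverse adj-sym xs c , Unique-reverse xs u

  Walk-reverse : (∀ a b → Adj G a b → Adj G b a) → ∀ {a b ws} → Walk G a b ws → ∃ λ rs → Walk G b a rs
  Walk-reverse adj-sym {a} {ws = ws} ((vs , c) , l) with Last⇒reverse l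
  ... | rs , rev≡ = rs , subst (λ zs → IsWalk G zs × Last a zs) rev≡
                             ((All-reverse vs , Consec-reverse adj-sym _ c) , Last-reverse ws)

  Walk-++ : ∀ {a t b ws vs} → Walk G a t ws → Walk G t b vs → Walk G a b (ws ++ vs)
  Walk-++ ((va , ca) , la) ((_ ∷ vvs , ct) , lt) = (All.++⁺ va vvs , Consec-join ca la ct) , Last-join la lt

  path⇒≤ₑ : ∀ {a b c d ps} zs → IsPath G (a ∷ b ∷ ps) → a ∷ b ∷ ps ≡ zs ++ c ∷ d ∷ [] →
            _≤ₑ_ G (a , b) (c , d)
  path⇒≤ₑ {c = c} {d} zs p eq =
    inj₂ (_ , reverse zs , p , trans (cong reverse eq) (reverse-++ zs (c ∷ d ∷ [])))

module _ {n : ℕ} {G : Graph n} (simple : IsSimpleGraph G) (acyclic : Acyclic G) where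

  private
    endpoints   = proj₁ simple
    adj-sym     = proj₁ (proj₂ simple)
    irreflexive = proj₂ (proj₂ simple)

  avoiding-walk : ∀ {h u t S} → IsPath G (h ∷ u ∷ S) → Last t (h ∷ u ∷ S) → Walk (G ↾ (h ≢_)) u t S
  avoiding-walk (_ ∷ vs , (_ , c) , h∉ ∷ _) (skip l) = (All.zip (vs , h∉) , Consec-mono (λ _ _ e → e) _ c) , l

  -- Otherwise the two paths, minus h, contain a path from u to u′ that closes a cycle through h.
  first-step-unique : ∀ {h u u′ t S S′} → IsPath G (h ∷ u ∷ S) → IsPath G (h ∷ u′ ∷ S′) →
                      Last t (h ∷ u ∷ S) → Last t (h ∷ u′ ∷ S′) → u ≡ u′
  first-step-unique {h} {u} {u′} {S = S} p@(vh ∷ _ , (ehu , _) , _) p′@(_ , (ehu′ , _) , _) l l′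
    with u ≟ u′
  ... | yes u≡u′ = u≡u′
  ... | no u≢u′ with Walk-reverse (G ↾ (h ≢_)) adj-sym (avoiding-walk p′ l′)
  ... | rs , back with walk⇒path (G ↾ (h ≢_)) (S ++ rs) (Walk-++ (G ↾ (h ≢_)) (avoiding-walk p l) back)
  ... | qs , (vqs , cqs , uqs) , lq =
    ⊥-elim (acyclic h u′ (h ∷ u ∷ qs) cycle (length≥3 qs lq) (adj-sym h u′ ehu′))
    where
      cycle : PathBetween G h u′ (h ∷ u ∷ qs)
      cycle = Last⇒PathBetween G
        ( vh ∷ All.map proj₁ vqs
        , (ehu , Consec-mono (λ _ _ e → e) _ cqs)
        , All.map proj₂ vqs ∷ uqs)
        (skip lq)
      length≥3 : ∀ qs → Last u′ (u ∷ qs) → 3 ≤ length (h ∷ u ∷ qs)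
      length≥3 []      end = ⊥-elim (u≢u′ refl)
      length≥3 (_ ∷ _) _   = s≤s (s≤s (s≤s z≤n))

  ≤ₑ⇒path-back : ∀ {x y a t} → Adj G x y → _≤ₑ_ G (x , y) (a , t) →
                 ∃ λ qs → IsPath G (t ∷ a ∷ qs) × Last x (t ∷ a ∷ qs)
  ≤ₑ⇒path-back {x} {y} exy (inj₁ (refl , refl)) =
    [] , (vy ∷ vx ∷ [] , (adj-sym x y exy , tt) , (y≢x ∷ []) ∷ [] ∷ []) , skip end
    where
      vx = proj₁ (endpoints x y exy)
      vy = proj₂ (endpoints x y exy)
      y≢x : y ≢ x
      y≢x refl = irreflexive x exy
  ≤ₑ⇒path-back {x} {y} _ (inj₂ (ps , qs , p , rev≡)) =
    qs , subst (IsPath G) rev≡ (IsPath-reverse G adj-sym _ p) , subst (Last x) rev≡ (Last-reverse (y ∷ ps))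

  ≤ₑ-incoming-unique : ∀ {x y a a′ t} → Adj G x y →
                       _≤ₑ_ G (x , y) (a , t) → _≤ₑ_ G (x , y) (a′ , t) → a ≡ a′
  ≤ₑ-incoming-unique exy o o′ with ≤ₑ⇒path-back exy o | ≤ₑ⇒path-back exy o′
  ... | _ , p , l | _ , p′ , l′ = first-step-unique p p′ l l′

  path-to-neighbour : ∀ {a b D} → IsPath G (b ∷ D) → Last a (b ∷ D) → Adj G a b → D ≡ [ a ]
  path-to-neighbour {D = []}          _ end        e = ⊥-elim (irreflexive _ e)
  path-to-neighbour {D = _ ∷ []}      _ (skip end) _ = refl
  path-to-neighbour {a} {b} {_ ∷ _ ∷ _} p l        e =
    ⊥-elim (acyclic b a _ (Last⇒PathBetween G p l) (s≤s (s≤s (s≤s z≤n))) e)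

module Subtree {n : ℕ} (T : Graph n) (tree : IsTree T) (x y : Fin n) (exy : Adj T x y) where

  open import Data.List.Membership.DecPropositional (_≟_ {n}) using (_∈?_)

  private
    simple      = proj₁ tree
    endpoints   = proj₁ simple
    adj-sym     = proj₁ (proj₂ simple)
    irreflexive = proj₂ (proj₂ simple)
    acyclic     = proj₂ (proj₂ tree)
    T-x = Minus T x y
    S   = SubT T x y
    vx  = proj₁ (endpoints x y exy)
    vy  = proj₂ (endpoints x y exy)

  y≢x : y ≢ x
  y≢x refl = irreflexive x exy

  y∈comp : InComp T x y y
  y∈comp = [ y ] , Last⇒PathBetween T-x ((vy , y≢x) ∷ [] , tt , [] ∷ []) end

  comp-step : ∀ {a b} → InComp T x y a → Adj T-x a b → InComp T x y b
  comp-step {a} {b} ia e@(eT , _ , b≢x) with PathBetween⇒Last T-x (proj₂ ia)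
  ... | qs , (vs , c , _) , l
      with walk⇒path T-x (qs ∷ʳ b)
             ((All.++⁺ vs ((proj₂ (endpoints a b eT) , b≢x) ∷ []) , Consec-join T-x c l (e , tt)) ,
              Last-∷ʳ (y ∷ qs))
  ... | qs′ , p′ , l′ = y ∷ qs′ , Last⇒PathBetween T-x p′ l′

  comp-walk : ∀ {c} qs → InComp T x y c → Consec T-x (c ∷ qs) → IsWalk S (c ∷ qs)
  comp-walk []       ic _        = inj₁ ic ∷ [] , tt
  comp-walk (d ∷ qs) ic (e , cs) with comp-walk qs (comp-step ic e) cs
  ... | vs , cs′ = inj₁ ic ∷ vs , inj₁ (e , ic , comp-step ic e) , cs′

  walk-from-x : ∀ v → Vx S v → ∃ λ ws → Walk S x v ws
  walk-from-x v (inj₂ refl) = [] , (inj₂ refl ∷ [] , tt) , end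
  walk-from-x v (inj₁ iv) with PathBetween⇒Last T-x (proj₂ iv)
  ... | qs , (_ , c , _) , l with comp-walk qs y∈comp c
  ... | vs , cs = y ∷ qs , (inj₂ refl ∷ vs , inj₂ (inj₁ (refl , refl)) , cs) , skip l

  S⊆T : Subgraph S T
  S⊆T = vertex , edge
    where
      vertex : ∀ v → Vx S v → Vx T v
      vertex v (inj₂ refl) = vx
      vertex v (inj₁ iv) with PathBetween⇒Last T-x (proj₂ iv)
      ... | _ , (vs , _) , l = proj₁ (All.lookup vs (Last⇒∈ l))
      edge : ∀ a b → Adj S a b → Adj T a b
      edge a b (inj₁ ((e , _) , _))          = e
      edge a b (inj₂ (inj₁ (refl , refl))) = exy
      edge a b (inj₂ (inj₂ (refl , refl))) = adj-sym x y exy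

  S-adj-sym : ∀ a b → Adj S a b → Adj S b a
  S-adj-sym a b (inj₁ ((e , a≢x , b≢x) , ia , ib)) = inj₁ ((adj-sym a b e , b≢x , a≢x) , ib , ia)
  S-adj-sym a b (inj₂ (inj₁ (a≡x , b≡y)))          = inj₂ (inj₂ (b≡y , a≡x))
  S-adj-sym a b (inj₂ (inj₂ (a≡y , b≡x)))          = inj₂ (inj₁ (b≡x , a≡y))

  S-simple : IsSimpleGraph S
  S-simple = S-endpoints , S-adj-sym , S-irreflexive
    where
      S-endpoints : ∀ a b → Adj S a b → Vx S a × Vx S b
      S-endpoints a b (inj₁ (_ , ia , ib))         = inj₁ ia , inj₁ ib
      S-endpoints a b (inj₂ (inj₁ (refl , refl))) = inj₂ refl , inj₁ y∈comp
      S-endpoints a b (inj₂ (inj₂ (refl , refl))) = inj₁ y∈comp , inj₂ refl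
      S-irreflexive : ∀ a → ¬ Adj S a a
      S-irreflexive a (inj₁ ((e , _) , _))        = irreflexive a e
      S-irreflexive a (inj₂ (inj₁ (refl , y≡x))) = y≢x (sym y≡x)
      S-irreflexive a (inj₂ (inj₂ (refl , y≡x))) = y≢x y≡x

  S-connected : Connected S
  S-connected a b va vb with walk-from-x a va | walk-from-x b vb
  ... | _ , wa | _ , wb with Walk-reverse S S-adj-sym wa
  ... | ra , wa⁻¹ with walk⇒path S _ (Walk-++ S wa⁻¹ wb)
  ... | qs , p , l = a ∷ qs , Last⇒PathBetween S p l

  S-acyclic : Acyclic S
  S-acyclic a b ps (p , h , hr) len e =
    acyclic a b ps (IsPath-mono S⊆T ps p , h , hr) len (proj₂ S⊆T b a e)

  S-isTree : IsTree S
  S-isTree = S-simple , S-connected , S-acyclic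

  _≤e_ : Fin n × Fin n → Fin n × Fin n → Set
  _≤e_ = _≤ₑ_ T

  prepend-x : ∀ {qs} → IsPath T-x (y ∷ qs) → IsPath T (x ∷ y ∷ qs)
  prepend-x (vs , c , u) =
    vx ∷ All.map proj₁ vs ,
    (exy , Consec-mono (λ _ _ → proj₁) _ c) ,
    All.map (λ { (_ , v≢x) x≡v → v≢x (sym x≡v) }) vs ∷ u

  edge-away : ∀ {a b qs} → IsPath T (x ∷ y ∷ qs) → Last a (y ∷ qs) → Adj T a b → b ∉ x ∷ y ∷ qs →
              (x , y) ≤e (a , b)
  edge-away {a} {b} {qs} (vs , c , u) l e b∉ with Last⇒∷ʳ l
  ... | ws , y∷qs≡ = path⇒≤ₑ T (x ∷ ws) extended
        (cong (x ∷_) (trans (cong (_∷ʳ b) y∷qs≡) (++-assoc ws [ a ] [ b ])))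
    where
      extended : IsPath T (x ∷ y ∷ qs ∷ʳ b)
      extended = All.++⁺ vs (proj₂ (endpoints a b e) ∷ []) ,
                 Consec-join T c (skip l) (e , tt) ,
                 Unique-∷ʳ (x ∷ y ∷ qs) u b∉

  -- b lies on the path from y to its neighbour a, so in a tree it is the vertex just before a.
  edge-toward : ∀ {a b qs} X {D} → IsPath T (x ∷ y ∷ qs) → Last a (y ∷ qs) → Adj T a b →
                y ∷ qs ≡ X ++ [ b ] ++ D → (x , y) ≤e (b , a)
  edge-toward {a} X p l e eq
    with path-to-neighbour simple acyclic
           (IsPath-++⁻ʳ T (x ∷ X) (subst (λ zs → IsPath T (x ∷ zs)) eq p))
           (Last-++⁻ʳ X (subst (Last a) eq l)) e
  ... | refl = path⇒≤ₑ T (x ∷ X) p (cong (x ∷_) eq)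

  S-edge-oriented : ∀ a b → Adj S a b → (x , y) ≤e (a , b) ⊎ (x , y) ≤e (b , a)
  S-edge-oriented a b (inj₂ (inj₁ (refl , refl))) = inj₁ (inj₁ (refl , refl))
  S-edge-oriented a b (inj₂ (inj₂ (refl , refl))) = inj₂ (inj₁ (refl , refl))
  S-edge-oriented a b (inj₁ ((e , _ , b≢x) , ia , _)) with PathBetween⇒Last T-x (proj₂ ia)
  ... | qs , p , l with b ∈? y ∷ qs
  ... | no b∉  = inj₁ (edge-away (prepend-x p) l e λ { (here b≡x) → b≢x b≡x ; (there b∈) → b∉ b∈ })
  ... | yes b∈ with ∈-∃++ b∈
  ... | X , _ , eq = inj₂ (edge-toward X (prepend-x p) l e eq)

module _ {V : Set} where

  ≤ₛ-trans : {r s t : Sep V} → r ≤ₛ s → s ≤ₛ t → r ≤ₛ t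
  ≤ₛ-trans (f , g) (f′ , g′) = (λ v → f′ v ∘ f v) , (λ v → g v ∘ g′ v)

  ∧ₛ-lowerˡ : {s t : Sep V} → s ∧ₛ t ≤ₛ s
  ∧ₛ-lowerˡ = (λ _ → proj₁) , (λ _ → inj₁)

  ∨ₛ-upperˡ : {s t : Sep V} → s ≤ₛ s ∨ₛ t
  ∨ₛ-upperˡ = (λ _ → inj₁) , (λ _ → proj₁)

  ∧ₛ-monoˡ : {s t u : Sep V} → s ≤ₛ t → s ∧ₛ u ≤ₛ t ∧ₛ u
  ∧ₛ-monoˡ (f , g) = (λ { v (l , l′) → f v l , l′ }) , (λ { v (inj₁ r) → inj₁ (g v r) ; v (inj₂ r) → inj₂ r })

  ∨ₛ-monoˡ : {s t u : Sep V} → s ≤ₛ t → s ∨ₛ u ≤ₛ t ∨ₛ u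
  ∨ₛ-monoˡ (f , g) = (λ { v (inj₁ l) → inj₁ (f v l) ; v (inj₂ l) → inj₂ l }) , (λ { v (r , r′) → g v r , r′ })

  star-∨∧ : {t u s : Sep V} → t ≤ₛ u * → t ∨ₛ s ≤ₛ (u ∧ₛ s *) *
  star-∨∧ {t} {u} {s} = ∨ₛ-monoˡ {t} {u *} {s}

  star-∧∨ : {t u s : Sep V} → t ≤ₛ u * → t ∧ₛ s * ≤ₛ (u ∨ₛ s) *
  star-∧∨ {t} {u} {s} = ∧ₛ-monoˡ {t} {u *} {s *}

  star-∧∧ : {t u s : Sep V} → t ≤ₛ u * → t ∧ₛ s * ≤ₛ (u ∧ₛ s *) *
  star-∧∧ {t} {u} {s} t≤u* =
    ≤ₛ-trans {r = t ∧ₛ s *} {t} {u * ∨ₛ s} (∧ₛ-lowerˡ {s = t} {s *})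
             (≤ₛ-trans {r = t} {u *} {u * ∨ₛ s} t≤u* (∨ₛ-upperˡ {s = u *} {s}))

module Shift {V : Set} (𝕊 : Universe V) {n : ℕ} (T : Graph n)
  (α : AlphaMap 𝕊 T) (tame-tree : IsTameSTree 𝕊 T α)
  (x y : Fin n) (exy : Adj T x y) (s : Sep V) (s∈S : _∈S 𝕊 s)
  (α′ : AlphaMap 𝕊 (SubT T x y)) (shift : IsShift T x y α s α′) where

  open Subtree T (proj₁ (proj₁ tame-tree)) x y exy public

  private
    S = SubT T x y
    α∈S      = proj₁ (proj₂ (proj₁ tame-tree))
    α-inv    = proj₂ (proj₂ (proj₁ tame-tree))
    α-tame   = proj₂ tame-tree
    T-simple  = proj₁ (proj₁ (proj₁ tame-tree))
    T-acyclic = proj₂ (proj₂ (proj₁ (proj₁ tame-tree)))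

    ⇑ : ∀ {a b} → Adj S a b → Adj T a b
    ⇑ = proj₂ S⊆T _ _

  shift-away : ∀ {a b} (e : Adj S a b) → (x , y) ≤e (a , b) → α′ a b e ≡ α a b (⇑ e) ∨ₛ s
  shift-away {a} {b} e = proj₁ (shift a b e (⇑ e))

  shift-toward : ∀ {a b} (e : Adj S a b) → (x , y) ≤e (b , a) → α′ a b e ≡ α a b (⇑ e) ∧ₛ (s *)
  shift-toward {a} {b} e = proj₂ (shift a b e (⇑ e))

  α′∈S : ∀ a b (e : Adj S a b) → _∈S 𝕊 (α′ a b e)
  α′∈S a b e with S-edge-oriented a b e
  ... | inj₁ o = subst (_∈S 𝕊) (sym (shift-away e o)) (∨-closed 𝕊 _ _ (α∈S a b (⇑ e)) s∈S)
  ... | inj₂ o = subst (_∈S 𝕊) (sym (shift-toward e o))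
                   (∧-closed 𝕊 _ _ (α∈S a b (⇑ e)) (*-closed 𝕊 s s∈S))

  α′-involution : ∀ a b (e : Adj S a b) (e′ : Adj S b a) → α′ b a e′ ≡ α′ a b e *
  α′-involution a b e e′ with S-edge-oriented a b e
  ... | inj₁ o = begin
    α′ b a e′                 ≡⟨ shift-toward e′ o ⟩
    α b a (⇑ e′) ∧ₛ (s *)     ≡⟨ cong (_∧ₛ (s *)) (α-inv a b (⇑ e) (⇑ e′)) ⟩
    (α a b (⇑ e) ∨ₛ s) *      ≡⟨ cong _* (sym (shift-away e o)) ⟩
    α′ a b e *                ∎
    where open ≡-Reasoning
  ... | inj₂ o = begin
    α′ b a e′                 ≡⟨ shift-away e′ o ⟩
    α b a (⇑ e′) ∨ₛ s         ≡⟨ cong (_∨ₛ s) (α-inv a b (⇑ e) (⇑ e′)) ⟩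
    (α a b (⇑ e) ∧ₛ (s *)) *  ≡⟨ cong _* (sym (shift-toward e o)) ⟩
    α′ a b e *                ∎
    where open ≡-Reasoning

  α′-tame : IsTame 𝕊 S α′
  α′-tame t a a′ e e′ a≢a′ = by-orientation (S-edge-oriented a t e) (S-edge-oriented a′ t e′)
    where
      αₐ  = α a t (⇑ e)
      αₐ′ = α a′ t (⇑ e′)
      star : αₐ ≤ₛ αₐ′ *
      star = α-tame t a a′ (⇑ e) (⇑ e′) a≢a′
      _≤*_ : Sep V → Sep V → Set
      u ≤* v = u ≤ₛ v *
      by-orientation : (x , y) ≤e (a , t) ⊎ (x , y) ≤e (t , a) →
                       (x , y) ≤e (a′ , t) ⊎ (x , y) ≤e (t , a′) → α′ a t e ≤* α′ a′ t e′
      by-orientation (inj₁ o) (inj₁ o′) = ⊥-elim (a≢a′ (≤ₑ-incoming-unique T-simple T-acyclic exy o o′))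
      by-orientation (inj₁ o) (inj₂ o′) = subst₂ _≤*_ (sym (shift-away e o)) (sym (shift-toward e′ o′))
                                            (star-∨∧ {t = αₐ} {u = αₐ′} {s = s} star)
      by-orientation (inj₂ o) (inj₁ o′) = subst₂ _≤*_ (sym (shift-toward e o)) (sym (shift-away e′ o′))
                                            (star-∧∨ {t = αₐ} {u = αₐ′} {s = s} star)
      by-orientation (inj₂ o) (inj₂ o′) = subst₂ _≤*_ (sym (shift-toward e o)) (sym (shift-toward e′ o′))
                                            (star-∧∧ {t = αₐ} {u = αₐ′} {s = s} star)

lemma2p7 : {V : Set} (𝕊 : Universe V) {n : ℕ} (T : Graph n)
    (α : AlphaMap 𝕊 T) → IsTameSTree 𝕊 T α →
    (x y : Fin n) (exy : Adj T x y) →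
    (s : Sep V) → _∈S 𝕊 s → α x y exy ≤ₛ s →
    (α' : AlphaMap 𝕊 (SubT T x y)) → IsShift T x y α s α' →
    IsTameSTree 𝕊 (SubT T x y) α'
lemma2p7 𝕊 T α tame-tree x y exy s s∈S _ α′ shift =
  (S-isTree , α′∈S , α′-involution) , α′-tame
  where open Shift 𝕊 T α tame-tree x y exy s s∈S α′ shift
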